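{- Let $r\ge 1$ be an integer. The edges of any $r$-orientable graph $G$ can be colored with $r$ colors such that for every pair of distinct vertices $u,v$ and every color, there are at most $2$ paths from $u$ to $v$ all of whose edges have that color.
   Context: A graph is $r$-orientable if its edges can be oriented so that every vertex has in-degree at most $r$. -}

module Defs where

open import Data.Nat using (ℕ; _≤_)
open import Data.Fin using (Fin)
open import Data.Bool using (Bool; true; false; _∨_)
open import Data.List using (List; []; _∷_; [_]; length; filterᵇ; allFin)
open import Relation.Binary.PropositionalEquality using (_≡_)
open import Data.Product using (Σ)

record Graph (n : ℕ) : Set where
  field
    adj   : Fin n → Fin n → Bool
    sym   : ∀ u v → adj u v ≡ adj v u
    irrefl : ∀ u → adj u u ≡ false
open Graph public

-- An orientation of G: arc u v = true means the edge uv is oriented u → v.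
-- Arcs only on edges, and every edge gets exactly one direction.
record Orientation {n : ℕ} (G : Graph n) : Set where
  field
    arc       : Fin n → Fin n → Bool
    arc⇒adj   : ∀ u v → arc u v ≡ true → adj G u v ≡ true
    adj⇒arc   : ∀ u v → adj G u v ≡ true → arc u v ∨ arc v u ≡ true
    antisym   : ∀ u v → arc u v ≡ true → arc v u ≡ false
open Orientation public

inDegree : ∀ {n} {G : Graph n} → Orientation G → Fin n → ℕ
inDegree {n} O v = length (filterᵇ (λ u → arc O u v) (allFin n))

IsOrientable : ∀ {n} → ℕ → Graph n → Set
IsOrientable r G = Σ (Orientation G) (λ O → ∀ v → inDegree O v ≤ r)

record EdgeColouring {n : ℕ} (r : ℕ) (G : Graph n) : Set where
  field
    colour    : Fin n → Fin n → Fin r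
    colourSym : ∀ u v → adj G u v ≡ true → colour u v ≡ colour v u
open EdgeColouring public

data MonoWalk {n r : ℕ} (G : Graph n) (c : EdgeColouring r G) (i : Fin r)
     : Fin n → Fin n → List (Fin n) → Set where
  stop : ∀ {u} → MonoWalk G c i u u [ u ]
  step : ∀ {u w v ws} → adj G u w ≡ true → colour c u w ≡ i →
         MonoWalk G c i w v ws → MonoWalk G c i u v (u ∷ ws)

-- Suppose every edge uw of
--     colour i satisfies p w ≡ u or p u ≡ w for a fixed map p ("parent").
--     A simple walk in colour i from u to v first climbs a steps along p and
--     then descends b steps towards v (a descent followed by a climb would
--     return to the previous vertex); call this shape a route.  Such a route
--     is determined by a, and a longer climb forces a shorter descent.  Three
--     routes a₁ < a₂ < a₃ are impossible: routes 1,2 and routes 2,3 each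
--     close a cycle, and one of these cycles already lies on the climb of
--     route 3 or on the descent of route 1, which are simple.
--
-- Fix an orientation with in-degrees at most r and give
--     each arc x → w the position of x in the list of in-neighbours of w.
--     Then every vertex has at most one in-arc of each colour, so the colour
--     class i lies in the graph of the map sending w to that in-neighbour.

module Submission where

open import Defs renaming (sym to adj-sym)
open import Data.Nat using (ℕ; zero; suc; _+_; _≤_; _<_; z≤n; s≤s)
open import Data.Nat.Properties
  using (_≟_; <-cmp; ≤-refl; <⇒≤; ≤-trans; ≤-reflexive; ≤-antisym; ≮⇒≥; ≤∧≢⇒<;
         ≤-total; m<m+n; +-assoc; +-suc; +-monoʳ-≤; m≤n⇒∃[o]m+o≡n)
open import Data.Fin as Fin using (Fin; inject≤)
open import Data.Fin.Properties using (any?; inject≤-injective)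
open import Data.Bool as Bool using (true; false; T; if_then_else_)
open import Data.Bool.Properties using (T?)
open import Data.Unit using (tt)
open import Data.List using (List; []; _∷_; length; filterᵇ; allFin)
open import Data.List.Membership.Propositional using (_∈_)
open import Data.List.Membership.Propositional.Properties using (∈-filter⁺; ∈-allFin)
import Data.List.Membership.DecPropositional as DecMembership
open import Data.List.Membership.Setoid.Properties using (index-injective)
open import Data.List.Relation.Unary.Any as Any using (here; there)
open import Data.List.Relation.Unary.All as All using (All; _∷_)
open import Data.List.Relation.Unary.AllPairs using (_∷_)
open import Data.List.Relation.Unary.Unique.Propositional using (Unique)
open import Data.Product using (Σ; _×_; _,_; ∃; ∃₂)
open import Data.Sum using (_⊎_; inj₁; inj₂)
open import Data.Empty using (⊥; ⊥-elim)
open import Relation.Binary using (tri<; tri≈; tri>)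
open import Relation.Binary.PropositionalEquality
  using (_≡_; _≢_; refl; sym; trans; cong; subst; setoid; module ≡-Reasoning)
open import Relation.Nullary using (¬_; Dec; yes; no)
open import Relation.Nullary.Decidable using (_×-dec_)

gap : ∀ {m k} → m < k → ∃ λ d → k ≡ m + suc d
gap {m} m<k with m≤n⇒∃[o]m+o≡n m<k
... | d , m+d≡k = d , trans (sym m+d≡k) (sym (+-suc m d))

shorter-loop : ∀ {x s t t'} → t ≤ t' → x + (s + t) ≤ x + s + t'
shorter-loop {x} {s} {t} t≤t' = ≤-trans (≤-reflexive (sym (+-assoc x s t))) (+-monoʳ-≤ (x + s) t≤t')

module Iteration {A : Set} (p : A → A) where

  iter : ℕ → A → A
  iter zero    x = x
  iter (suc k) x = iter k (p x)

  iter-suc : ∀ k x → iter (suc k) x ≡ p (iter k x)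
  iter-suc zero    x = refl
  iter-suc (suc k) x = iter-suc k (p x)

  iter-+ : ∀ m k x → iter (m + k) x ≡ iter k (iter m x)
  iter-+ zero    k x = refl
  iter-+ (suc m) k x = iter-+ m k (p x)

  closes : ∀ {x y} m k → iter m x ≡ y → iter k y ≡ x → iter (m + k) x ≡ x
  closes {x} m k to back = trans (iter-+ m k x) (trans (cong (iter k) to) back)

  -- Two meeting points of the orbits of u and v, iter a u ≡ iter (b + β) v and
  -- iter (a + α) u ≡ iter b v, lie on a common cycle of length α + β; it is
  -- recorded once as seen from each of the two points.
  module _ {u v : A} {a b α β : ℕ}
           (meet₁ : iter a u ≡ iter (b + β) v) (meet₂ : iter (a + α) u ≡ iter b v) where

    cycle-on-climb : iter (a + (α + β)) u ≡ iter a u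
    cycle-on-climb =
      trans (iter-+ a (α + β) u)
            (closes α β (trans (sym (iter-+ a α u)) meet₂)
                        (trans (sym (iter-+ b β v)) (sym meet₁)))

    cycle-on-descent : iter (b + (β + α)) v ≡ iter b v
    cycle-on-descent =
      trans (iter-+ b (β + α) v)
            (closes β α (trans (sym (iter-+ b β v)) (sym meet₁))
                        (trans (sym (iter-+ a α u)) meet₂))

module FunctionalColourClass
  {n r : ℕ} (G : Graph n) (c : EdgeColouring r G) (i : Fin r) (p : Fin n → Fin n)
  (follows : ∀ {u w} → adj G u w ≡ true → colour c u w ≡ i → p w ≡ u ⊎ p u ≡ w)
  where

  open Iteration p

  module Towards (v : Fin n) where

    -- The last b vertices of a route: iter (b - 1) v, …, iter 1 v, v.
    descent : ℕ → List (Fin n)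
    descent zero    = []
    descent (suc b) = iter b v ∷ descent b

    route : Fin n → ℕ → ℕ → List (Fin n)
    route u zero    b = u ∷ descent b
    route u (suc a) b = u ∷ route (p u) a b

    descent∈ : ∀ {j b} → j < b → iter j v ∈ descent b
    descent∈ {j} {suc b} (s≤s j≤b) with j ≟ b
    ... | yes refl = here refl
    ... | no  j≢b  = there (descent∈ (≤∧≢⇒< j≤b j≢b))

    descent∈route : ∀ {u a b j} → j < b → iter j v ∈ route u a b
    descent∈route {a = zero}  j<b = there (descent∈ j<b)
    descent∈route {a = suc a} j<b = there (descent∈route j<b)

    climb∈route : ∀ {u a b j} → j ≤ a → iter j u ∈ route u a b
    climb∈route {a = zero}  {j = zero}  _         = here refl
    climb∈route {a = suc a} {j = zero}  _         = here refl
    climb∈route {a = suc a} {j = suc j} (s≤s j≤a) = there (climb∈route j≤a)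

    -- A simple walk of colour i from u to v is a route.  A step against p
    -- (p w ≡ u) can only come after the climb has ended: otherwise the walk
    -- would revisit u as the parent of w.
    walk-is-route : ∀ {u ws} → MonoWalk G c i u v ws → Unique ws →
                    ∃₂ λ a b → iter a u ≡ iter b v × ws ≡ route u a b
    walk-is-route stop _ = 0 , 0 , refl , refl
    walk-is-route {u} (step {w = w} uw uw-col W) (u∉ws ∷ unique)
      with walk-is-route W unique | follows uw uw-col
    ... | a , b , meet , refl | inj₂ pu≡w =
      suc a , b , trans (cong (iter a) pu≡w) meet , cong (λ x → u ∷ route x a b) (sym pu≡w)
    ... | suc a , b , _ , refl | inj₁ pw≡u =
      ⊥-elim (All.lookup u∉ws (climb∈route {j = 1} (s≤s z≤n)) (sym pw≡u))
    ... | zero , b , meet , refl | inj₁ pw≡u =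
      zero , suc b , u-below , cong (λ x → u ∷ x ∷ descent b) meet
      where
      open ≡-Reasoning
      u-below : u ≡ iter (suc b) v
      u-below = begin
        u              ≡⟨ sym pw≡u ⟩
        p w            ≡⟨ cong p meet ⟩
        p (iter b v)   ≡⟨ sym (iter-suc b v) ⟩
        iter (suc b) v ∎

    record Route (u : Fin n) (a b : ℕ) : Set where
      field
        meets          : iter a u ≡ iter b v
        climb-simple   : ∀ {k l} → k < l → l ≤ a → iter k u ≢ iter l u
        descent-simple : ∀ {k l} → k < l → l ≤ b → iter k v ≢ iter l v
        apart          : ∀ {k l} → k ≤ a → l < b → iter k u ≢ iter l v
    open Route

    unique-climb : ∀ {u a b k l} → Unique (route u a b) →
                   k < l → l ≤ a → iter k u ≢ iter l u
    unique-climb {a = suc a} {k = zero} {l = suc l} (u∉ ∷ _) _ (s≤s l≤a) =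
      All.lookup u∉ (climb∈route l≤a)
    unique-climb {a = suc a} {k = suc k} {l = suc l} (_ ∷ unique) (s≤s k<l) (s≤s l≤a) =
      unique-climb unique k<l l≤a

    unique-apart : ∀ {u a b k l} → Unique (route u a b) →
                   k ≤ a → l < b → iter k u ≢ iter l v
    unique-apart {a = zero}  (u∉ ∷ _) z≤n l<b = All.lookup u∉ (descent∈ l<b)
    unique-apart {a = suc a} (u∉ ∷ _) z≤n l<b = All.lookup u∉ (descent∈route l<b)
    unique-apart {a = suc a} (_ ∷ unique) (s≤s k≤a) l<b = unique-apart unique k≤a l<b

    unique-from-meeting : ∀ {u a b} → Unique (route u a b) → Unique (iter a u ∷ descent b)
    unique-from-meeting {a = zero}  unique       = unique
    unique-from-meeting {a = suc a} (_ ∷ unique) = unique-from-meeting unique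

    unique-descent : ∀ {m k l} → Unique (descent m) → k < l → l < m → iter k v ≢ iter l v
    unique-descent {suc m} {k} {l} (top∉ ∷ unique) k<l (s≤s l≤m) with l ≟ m
    ... | yes refl = λ eq → All.lookup top∉ (descent∈ k<l) (sym eq)
    ... | no  l≢m  = unique-descent unique k<l (≤∧≢⇒< l≤m l≢m)

    -- The descent is simple including its meeting point iter b v.
    unique-route : ∀ {u a b} → iter a u ≡ iter b v → Unique (route u a b) → Route u a b
    unique-route {b = b} meet unique = record
      { meets          = meet
      ; climb-simple   = unique-climb unique
      ; descent-simple = λ k<l l≤b → unique-descent tail k<l (s≤s l≤b)
      ; apart          = unique-apart unique
      }
      where
      tail : Unique (descent (suc b))
      tail = subst (λ x → Unique (x ∷ descent b)) meet (unique-from-meeting unique)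

    walk-route : ∀ {u ws} → MonoWalk G c i u v ws → Unique ws →
                 ∃₂ λ a b → Route u a b × ws ≡ route u a b
    walk-route W unique with walk-is-route W unique
    ... | a , b , meet , refl = a , b , unique-route meet unique , refl

    module _ {u : Fin n} where

      -- The climb of a route determines its descent, since the descent is simple.
      descent-determined : ∀ {a b b'} → Route u a b → Route u a b' → b ≡ b'
      descent-determined R R' = ≤-antisym (≮⇒≥ (not-shorter R' R)) (≮⇒≥ (not-shorter R R'))
        where
        not-shorter : ∀ {a b b'} → Route u a b → Route u a b' → ¬ b < b'
        not-shorter R R' b<b' = descent-simple R' b<b' ≤-refl (trans (sym (meets R)) (meets R'))

      longer-climb-shorter-descent : ∀ {a b a' b'} → Route u a b → Route u a' b' → a < a' → b' < b
      longer-climb-shorter-descent {b = b} {b' = b'} R R' a<a' with <-cmp b' b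
      ... | tri< b'<b _ _ = b'<b
      ... | tri≈ _ refl _ = ⊥-elim (climb-simple R' a<a' ≤-refl (trans (meets R) (sym (meets R'))))
      ... | tri> _ _ b<b' = ⊥-elim (apart R' (<⇒≤ a<a') b<b' (meets R))

      climbs-differ : ∀ {a b a' b' ws ws'} →
                      Route u a b → ws ≡ route u a b → Route u a' b' → ws' ≡ route u a' b' →
                      ws ≢ ws' → a ≢ a'
      climbs-differ R refl R' refl ws≢ws' refl with descent-determined R R'
      ... | refl = ws≢ws' refl

      -- With climbs a₁ < a₂ < a₃ (gaps α, γ) and descents b₁ > b₂ > b₃ (gaps β, δ),
      -- routes 1,2 close a cycle of length α + β through iter a₁ u and routes 2,3
      -- one of length γ + δ through iter b₃ v.  If β ≤ γ the first cycle fits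
      -- inside the climb of route 3, otherwise the second fits inside the
      -- descent of route 1; either way a simple part of a route repeats a vertex.
      no-three-increasing : ∀ {a₁ b₁ a₂ b₂ a₃ b₃} →
                            Route u a₁ b₁ → Route u a₂ b₂ → Route u a₃ b₃ →
                            a₁ < a₂ → a₂ < a₃ → ⊥
      no-three-increasing {a₁ = a₁} {b₂ = b₂} {b₃ = b₃} R₁ R₂ R₃ a₁<a₂ a₂<a₃
        with gap a₁<a₂ | gap a₂<a₃
           | gap (longer-climb-shorter-descent R₁ R₂ a₁<a₂)
           | gap (longer-climb-shorter-descent R₂ R₃ a₂<a₃)
      ... | α , refl | γ , refl | β , refl | δ , refl with ≤-total β γ
      ... | inj₁ β≤γ =
        climb-simple R₃ (m<m+n a₁ (s≤s z≤n)) (shorter-loop {a₁} {suc α} (s≤s β≤γ))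
          (sym (cycle-on-climb {u} {v} {a₁} {b₂} {suc α} {suc β} (meets R₁) (meets R₂)))
      ... | inj₂ γ≤β =
        descent-simple R₁ (m<m+n b₃ (s≤s z≤n)) (shorter-loop {b₃} {suc δ} (s≤s γ≤β))
          (sym (cycle-on-descent {u} {v} {a₁ + suc α} {b₃} {suc γ} {suc δ} (meets R₂) (meets R₃)))

      no-three-distinct : ∀ {a₁ b₁ a₂ b₂ a₃ b₃} →
                          Route u a₁ b₁ → Route u a₂ b₂ → Route u a₃ b₃ →
                          a₁ ≢ a₂ → a₁ ≢ a₃ → a₂ ≢ a₃ → ⊥
      no-three-distinct {a₁} {_} {a₂} {_} {a₃} R₁ R₂ R₃ a₁≢a₂ a₁≢a₃ a₂≢a₃
        with <-cmp a₁ a₂ | <-cmp a₂ a₃ | <-cmp a₁ a₃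
      ... | tri≈ _ eq _ | _ | _ = a₁≢a₂ eq
      ... | _ | tri≈ _ eq _ | _ = a₂≢a₃ eq
      ... | _ | _ | tri≈ _ eq _ = a₁≢a₃ eq
      ... | tri< x _ _ | tri< y _ _ | _           = no-three-increasing R₁ R₂ R₃ x y
      ... | tri> _ _ x | tri> _ _ y | _           = no-three-increasing R₃ R₂ R₁ y x
      ... | tri< x _ _ | tri> _ _ y | tri< z _ _ = no-three-increasing R₁ R₃ R₂ z y
      ... | tri< x _ _ | tri> _ _ y | tri> _ _ z = no-three-increasing R₃ R₁ R₂ z x
      ... | tri> _ _ x | tri< y _ _ | tri< z _ _ = no-three-increasing R₂ R₁ R₃ x z
      ... | tri> _ _ x | tri< y _ _ | tri> _ _ z = no-three-increasing R₂ R₃ R₁ y z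

    -- Three distinct simple walks of colour i from u to v would be three
    -- routes with pairwise distinct climbs.
    at-most-two-walks : (u : Fin n) (ps : List (List (Fin n))) →
                        All (λ q → Unique q × MonoWalk G c i u v q) ps → Unique ps →
                        length ps ≤ 2
    at-most-two-walks u []              _ _ = z≤n
    at-most-two-walks u (_ ∷ [])        _ _ = s≤s z≤n
    at-most-two-walks u (_ ∷ _ ∷ [])    _ _ = s≤s (s≤s z≤n)
    at-most-two-walks u (_ ∷ _ ∷ _ ∷ _)
      ((uq₁ , W₁) ∷ (uq₂ , W₂) ∷ (uq₃ , W₃) ∷ _) ((p₁≢p₂ ∷ p₁≢p₃ ∷ _) ∷ (p₂≢p₃ ∷ _) ∷ _)
      with walk-route W₁ uq₁ | walk-route W₂ uq₂ | walk-route W₃ uq₃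
    ... | _ , _ , R₁ , e₁ | _ , _ , R₂ , e₂ | _ , _ , R₃ , e₃ =
      ⊥-elim (no-three-distinct R₁ R₂ R₃
               (climbs-differ R₁ e₁ R₂ e₂ p₁≢p₂)
               (climbs-differ R₁ e₁ R₃ e₃ p₁≢p₃)
               (climbs-differ R₂ e₂ R₃ e₃ p₂≢p₃))

module InNeighbourColouring {n r : ℕ} (G : Graph n) (O : Orientation G)
  (deg : ∀ w → inDegree O w ≤ suc r) where

  open DecMembership (Fin._≟_ {n}) using (_∈?_)

  inNbrs : Fin n → List (Fin n)
  inNbrs w = filterᵇ (λ x → arc O x w) (allFin n)

  arc⇒inNbr : ∀ {x w} → arc O x w ≡ true → x ∈ inNbrs w
  arc⇒inNbr {x} {w} x→w = ∈-filter⁺ (λ y → T? (arc O y w)) (∈-allFin x) (subst T (sym x→w) tt)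

  slot : Fin n → Fin n → Fin (suc r)
  slot x w with x ∈? inNbrs w
  ... | yes x∈ = inject≤ (Any.index x∈) (deg w)
  ... | no  _  = Fin.zero

  slot-injective : ∀ {x y w} → x ∈ inNbrs w → y ∈ inNbrs w → slot x w ≡ slot y w → x ≡ y
  slot-injective {x} {y} {w} x∈ y∈ eq with x ∈? inNbrs w | y ∈? inNbrs w
  ... | yes x∈' | yes y∈' = index-injective (setoid (Fin n)) x∈' y∈' (inject≤-injective _ _ _ _ eq)
  ... | no  x∉  | _       = ⊥-elim (x∉ x∈)
  ... | _       | no  y∉  = ⊥-elim (y∉ y∈)

  oriented : ∀ {u w} → adj G u w ≡ true → arc O u w ≡ true ⊎ arc O w u ≡ true
  oriented {u} {w} uw with arc O u w | arc O w u | adj⇒arc O u w uw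
  ... | true  | _     | _  = inj₁ refl
  ... | false | true  | _  = inj₂ refl
  ... | false | false | ()

  col : Fin n → Fin n → Fin (suc r)
  col x w = if arc O x w then slot x w else slot w x

  col-along : ∀ {x w} → arc O x w ≡ true → col x w ≡ slot x w
  col-along {x} {w} x→w = cong (λ b → if b then slot x w else slot w x) x→w

  col-against : ∀ {x w} → arc O x w ≡ true → col w x ≡ slot x w
  col-against {x} {w} x→w = cong (λ b → if b then slot w x else slot x w) (antisym O x w x→w)

  col-sym : ∀ u w → adj G u w ≡ true → col u w ≡ col w u
  col-sym u w uw with oriented uw
  ... | inj₁ u→w = trans (col-along u→w) (sym (col-against u→w))
  ... | inj₂ w→u = trans (col-against w→u) (sym (col-along w→u))

  colouring : EdgeColouring (suc r) G
  colouring = record { colour = col ; colourSym = col-sym }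

  module _ (i : Fin (suc r)) where

    InArc : Fin n → Fin n → Set
    InArc x w = arc O x w ≡ true × col x w ≡ i

    InArc? : ∀ x w → Dec (InArc x w)
    InArc? x w = (arc O x w Bool.≟ true) ×-dec (col x w Fin.≟ i)

    in-arc-unique : ∀ {x y w} → InArc x w → InArc y w → x ≡ y
    in-arc-unique {x} {y} {w} (x→w , x-col) (y→w , y-col) =
      slot-injective (arc⇒inNbr x→w) (arc⇒inNbr y→w)
        (trans (sym (col-along x→w)) (trans x-col (trans (sym y-col) (col-along y→w))))

    -- The in-neighbour of w along colour i, or w itself if there is none.
    parent : Fin n → Fin n
    parent w with any? (λ x → InArc? x w)
    ... | yes (x , _) = x
    ... | no  _       = w

    parent-spec : ∀ {x w} → InArc x w → parent w ≡ x
    parent-spec {x} {w} x→w with any? (λ y → InArc? y w)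
    ... | yes (y , y→w) = in-arc-unique y→w x→w
    ... | no  none      = ⊥-elim (none (x , x→w))

    -- Colour class i lies in the graph of parent: an edge of colour i is an
    -- in-arc of colour i at one of its ends.
    follows-parent : ∀ {u w} → adj G u w ≡ true → col u w ≡ i →
                     parent w ≡ u ⊎ parent u ≡ w
    follows-parent {u} {w} uw uw-col with oriented uw
    ... | inj₁ u→w = inj₁ (parent-spec (u→w , uw-col))
    ... | inj₂ w→u = inj₂ (parent-spec (w→u , trans (col-sym w u (trans (adj-sym G w u) uw)) uw-col))

-- The in-neighbour colouring of an orientation witnessing r-orientability
-- satisfies part (1) in each colour.
lemma3p1 : (r : ℕ) → 1 ≤ r → (n : ℕ) → (G : Graph n) → IsOrientable r G →
    Σ (EdgeColouring r G) (λ c →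
      (u v : Fin n) → ¬ (u ≡ v) → (i : Fin r) →
      (ps : List (List (Fin n))) →
      All (λ p → Unique p × MonoWalk G c i u v p) ps → Unique ps →
      length ps ≤ 2)
lemma3p1 (suc r) _ n G (O , deg) =
  colouring , λ u v _ i → Towards.at-most-two-walks i (parent i) (follows-parent i) v u
  where
  open InNeighbourColouring G O deg
  open FunctionalColourClass G colouring
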